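{- Every highly normalizing combinator is strongly normalizing for $\rightarrow$: if $t\in HN$ then there is no infinite reduction sequence $t\rightarrow t_1\rightarrow t_2\rightarrow\cdots$.
   Context: Combinators: $C ::= x \mid K \mid S \mid I \mid (C\ C)$ with $x$ ranging over variables; application associates to the left. $\lambda x.u$ is defined by the first applicable rule: $\lambda x.u=(K\ u)$ if $x\notin u$; $\lambda x.x=I$; $\lambda x.(u\ v)=(S\ \lambda x.u\ \lambda x.v)$ otherwise. The reduction $\rightarrow$ is the closure under application contexts of $(K\ u\ v)\rightarrow u$, $(S\ u\ v\ w)\rightarrow(u\ w\ (v\ w))$, $(I\ u)\rightarrow u$, $(S\ (K\ u)\ (K\ v))\rightarrow(K\ (u\ v))$, $(S\ (K\ u)\ I)\rightarrow u$, plus: $\lambda x.u\rightarrow\lambda x.v$ whenever $u\rightarrow v$. The set $HN$ of highly normalizing combinators is the smallest set such that: (1) $S,K,I\in HN$, and $(x\ t_1\ \cdots\ t_n)\in HN$ for any variable $x$ and $t_1,\dots,t_n\in HN$ ($n\ge0$); (2) $(K\ t_1)\in HN$ and $(S\ t_1)\in HN$ if $t_1\in HN$; (3) $(S\ t_1\ t_2)\in HN$ if $(t_1\ x\ (t_2\ x))\in HN$ for a fresh variable $x$; (4) $(I\ t_1\ \cdots\ t_n)\in HN$ for $n\ge1$ if $(t_1\ t_2\ \cdots\ t_n)\in HN$; (5) $(K\ t_1\ \cdots\ t_n)\in HN$ for $n\ge2$ if $(t_1\ t_3\ \cdots\ t_n)\in HN$ and $t_2\in HN$; (6) $(S\ t_1\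 \cdots\ t_n)\in HN$ for $n\ge3$ if $(t_1\ t_3\ (t_2\ t_3)\ t_4\ \cdots\ t_n)\in HN$. -}

module Defs where

open import Data.Nat using (ℕ; suc)
open import Data.Nat.Properties using (_≟_)
open import Data.List using (List; []; _∷_)
open import Data.List.Relation.Unary.All using (All)
open import Data.Bool using (Bool; true; false; _∨_; if_then_else_)
open import Relation.Nullary.Decidable using (⌊_⌋)
open import Relation.Binary.PropositionalEquality using (_≡_)
open import Data.Product using (Σ; _×_)
open import Relation.Nullary using (¬_)

infixl 9 _·_ _·*_
infix 4 _⟶_

data Comb : Set where
  var : ℕ → Comb
  K S I : Comb
  _·_ : Comb → Comb → Comb

_·*_ : Comb → List Comb → Comb
t ·* []       = t
t ·* (u ∷ us) = (t · u) ·* us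

occurs : ℕ → Comb → Bool
occurs x (var y) = ⌊ x ≟ y ⌋
occurs x K = false
occurs x S = false
occurs x I = false
occurs x (u · v) = occurs x u ∨ occurs x v

_∉_ : ℕ → Comb → Set
x ∉ u = occurs x u ≡ false

-- Abstraction λx.u, first applicable rule
ƛ : ℕ → Comb → Comb
ƛ x u with occurs x u
... | false = K · u
ƛ x (var y) | true = I            -- occurs x (var y) = true means x = y
ƛ x K | true = K · K              -- unreachable
ƛ x S | true = K · S              -- unreachable
ƛ x I | true = K · I              -- unreachable
ƛ x (u · v) | true = S · ƛ x u · ƛ x v

data _⟶_ : Comb → Comb → Set where
  βK   : ∀ {u v} → K · u · v ⟶ u
  βS   : ∀ {u v w} → S · u · v · w ⟶ u · w · (v · w)
  βI   : ∀ {u} → I · u ⟶ u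
  ηKK  : ∀ {u v} → S · (K · u) · (K · v) ⟶ K · (u · v)
  ηKI  : ∀ {u} → S · (K · u) · I ⟶ u
  appL : ∀ {u u' v} → u ⟶ u' → u · v ⟶ u' · v
  appR : ∀ {u v v'} → v ⟶ v' → u · v ⟶ u · v'
  abs  : ∀ {x u v} → u ⟶ v → ƛ x u ⟶ ƛ x v

data HN : Comb → Set where
  hn-S   : HN S
  hn-K   : HN K
  hn-I   : HN I
  hn-var : ∀ x {ts} → All HN ts → HN (var x ·* ts)
  hn-K1  : ∀ {t₁} → HN t₁ → HN (K · t₁)
  hn-S1  : ∀ {t₁} → HN t₁ → HN (S · t₁)
  hn-S2  : ∀ {t₁ t₂} x → x ∉ t₁ → x ∉ t₂ →
           HN (t₁ · var x · (t₂ · var x)) → HN (S · t₁ · t₂)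
  hn-I*  : ∀ {t₁ ts} → HN (t₁ ·* ts) → HN (I · t₁ ·* ts)
  hn-K*  : ∀ {t₁ t₂ ts} → HN (t₁ ·* ts) → HN t₂ → HN (K · t₁ · t₂ ·* ts)
  hn-S*  : ∀ {t₁ t₂ t₃ ts} → HN (t₁ · t₃ · (t₂ · t₃) ·* ts) →
           HN (S · t₁ · t₂ · t₃ ·* ts)

InfiniteReduction : Comb → Set
InfiniteReduction t = Σ (ℕ → Comb) λ f → (f 0 ≡ t) × (∀ n → f n ⟶ f (suc n))

StronglyNormalizing : Comb → Set
StronglyNormalizing t = ¬ InfiniteReduction t

module Submission where

-- Strong normalization for ⟶ follows from strong normalization for _⇒_, which contains ⟶ and
-- spells out a step under ƛ y according to the shape of the compiled abstraction. The clauses of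
-- HN that are not immediate say that a head redex is strongly normalizing when its contractum
-- and the argument it erases are. This is generalised to marked expansions s ⊵ s′: s′ contracts
-- possibly nested marked redexes A · t of s, where A compiles some λx.w and t is strongly
-- normalizing. A step s ⇒ s₁ is simulated by an expansion s₁ ⊵ s₁′ such that either s′ ⇒⁺ s₁′,
-- or s₁′ = s′ and the total weight of the marks drops, or the weight is unchanged and an
-- argument erased by a mark makes a step. This descent is well founded when s′ is strongly
-- normalizing, so s is too. Going under ƛ requires that marks avoid the bound variable, which is
-- why expansions carry a list of avoided variables.

open import Defs
open import Data.Bool using (true; false; if_then_else_)
open import Data.Empty using (⊥-elim)
open import Data.List using (List; []; _∷_; _++_)
open import Data.List.Relation.Unary.All as All using (All; []; _∷_)
open import Data.Nat using (ℕ; suc; _+_; _⊔_; _≤_; _<_; z≤n; s≤s)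
open import Data.Nat.Induction using (<-wellFounded)
open import Data.Nat.Properties
  using (_≟_; ≤-refl; ≤-trans; ≤-reflexive; <-irrefl; <-≤-trans; <⇒≤; n<1+n; m≤n+m; m≤m⊔n; m≤n⊔m;
         +-mono-≤; +-mono-<-≤; +-mono-≤-<; +-monoˡ-<; +-monoʳ-<)
open import Data.Product using (Σ-syntax; _×_; _,_; proj₁; proj₂)
open import Data.Sum using (_⊎_; inj₁; inj₂)
open import Function using (_∘_)
open import Induction.WellFounded using (Acc; acc; WfRec; WellFounded)
open import Relation.Binary.Construct.Closure.ReflexiveTransitive using (Star; ε; _◅_; _◅◅_; gmap)
open import Relation.Binary.Construct.Closure.Transitive as Plus using (TransClosure; _∷ʳ_)
open import Relation.Binary.PropositionalEquality
open import Relation.Nullary using (¬_; Dec; does; yes; no)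
open import Relation.Nullary.Decidable using (dec-true; dec-false)

-- Free variables and substitution

infix 4 _∈_ _∈?_

data _∈_ (x : ℕ) : Comb → Set where
  here  : x ∈ var x
  left  : ∀ {u v} → x ∈ u → x ∈ u · v
  right : ∀ {u v} → x ∈ v → x ∈ u · v

_∈?_ : ∀ x u → Dec (x ∈ u)
x ∈? var y with x ≟ y
... | yes refl = yes here
... | no x≢y = no λ { here → x≢y refl }
x ∈? K = no λ ()
x ∈? S = no λ ()
x ∈? I = no λ ()
x ∈? u · v with x ∈? u | x ∈? v
... | yes x∈u | _ = yes (left x∈u)
... | no _ | yes x∈v = yes (right x∈v)
... | no x∉u | no x∉v = no λ { (left p) → x∉u p ; (right p) → x∉v p }

∉-· : ∀ {x u v} → ¬ x ∈ u → ¬ x ∈ v → ¬ x ∈ u · v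
∉-· x∉u x∉v (left p) = x∉u p
∉-· x∉u x∉v (right p) = x∉v p

occurs-∈ : ∀ {x u} → x ∈ u → occurs x u ≡ true
occurs-∈ {x} here with x ≟ x
... | yes _ = refl
... | no x≢x = ⊥-elim (x≢x refl)
occurs-∈ (left p) rewrite occurs-∈ p = refl
occurs-∈ {x} (right {u} p) rewrite occurs-∈ p with occurs x u
... | true = refl
... | false = refl

occurs-∉ : ∀ {x u} → ¬ x ∈ u → x ∉ u
occurs-∉ {x} {var y} x∉y with x ≟ y
... | yes refl = ⊥-elim (x∉y here)
... | no _ = refl
occurs-∉ {u = K} _ = refl
occurs-∉ {u = S} _ = refl
occurs-∉ {u = I} _ = refl
occurs-∉ {u = u · v} x∉uv
  rewrite occurs-∉ {u = u} (λ p → x∉uv (left p)) | occurs-∉ {u = v} (λ p → x∉uv (right p)) = refl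

∉-occurs : ∀ {x u} → x ∉ u → ¬ x ∈ u
∉-occurs x∉u x∈u with () ← trans (sym (occurs-∈ x∈u)) x∉u

∉-var : ∀ {x y} → ¬ x ∈ var y → x ≢ y
∉-var x∉y refl = x∉y here

infixl 8 _[_≔_]

_[_≔_] : Comb → ℕ → Comb → Comb
var y [ x ≔ s ] with x ≟ y
... | yes _ = s
... | no _  = var y
K [ x ≔ s ] = K
S [ x ≔ s ] = S
I [ x ≔ s ] = I
(u · v) [ x ≔ s ] = (u [ x ≔ s ]) · (v [ x ≔ s ])

[≔]-var-≡ : ∀ x s → var x [ x ≔ s ] ≡ s
[≔]-var-≡ x s with x ≟ x
... | yes _ = refl
... | no x≢x = ⊥-elim (x≢x refl)

[≔]-var-≢ : ∀ {x y} s → x ≢ y → var y [ x ≔ s ] ≡ var y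
[≔]-var-≢ {x} {y} s x≢y with x ≟ y
... | yes x≡y = ⊥-elim (x≢y x≡y)
... | no _ = refl

[≔]-∉ : ∀ {x s} u → ¬ x ∈ u → u [ x ≔ s ] ≡ u
[≔]-∉ (var y) x∉y = [≔]-var-≢ _ (∉-var x∉y)
[≔]-∉ K _ = refl
[≔]-∉ S _ = refl
[≔]-∉ I _ = refl
[≔]-∉ (u · v) x∉uv = cong₂ _·_ ([≔]-∉ u (x∉uv ∘ left)) ([≔]-∉ v (x∉uv ∘ right))

[≔]-id : ∀ x u → u [ x ≔ var x ] ≡ u
[≔]-id x (var y) with x ≟ y
... | yes x≡y = cong var x≡y
... | no _ = refl
[≔]-id x K = refl
[≔]-id x S = refl
[≔]-id x I = refl
[≔]-id x (u · v) = cong₂ _·_ ([≔]-id x u) ([≔]-id x v)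

∈-[≔]-≢ : ∀ {z x s u} → z ≢ x → z ∈ u → z ∈ u [ x ≔ s ]
∈-[≔]-≢ {s = s} z≢x here rewrite [≔]-var-≢ s (z≢x ∘ sym) = here
∈-[≔]-≢ z≢x (left p) = left (∈-[≔]-≢ z≢x p)
∈-[≔]-≢ z≢x (right p) = right (∈-[≔]-≢ z≢x p)

∈-[≔]-hit : ∀ {z x s u} → x ∈ u → z ∈ s → z ∈ u [ x ≔ s ]
∈-[≔]-hit {x = x} {s} here z∈s rewrite [≔]-var-≡ x s = z∈s
∈-[≔]-hit (left p) z∈s = left (∈-[≔]-hit p z∈s)
∈-[≔]-hit (right p) z∈s = right (∈-[≔]-hit p z∈s)

∈-[≔]⁻ : ∀ {z x s} u → z ∈ u [ x ≔ s ] → (z ≢ x × z ∈ u) ⊎ z ∈ s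
∈-[≔]⁻ {x = x} (var y) z∈ with x ≟ y
... | yes _ = inj₂ z∈
∈-[≔]⁻ (var y) here | no x≢y = inj₁ ((λ { refl → x≢y refl }) , here)
∈-[≔]⁻ (u · v) (left p) with ∈-[≔]⁻ u p
... | inj₁ (z≢x , z∈u) = inj₁ (z≢x , left z∈u)
... | inj₂ z∈s = inj₂ z∈s
∈-[≔]⁻ (u · v) (right p) with ∈-[≔]⁻ v p
... | inj₁ (z≢x , z∈v) = inj₁ (z≢x , right z∈v)
... | inj₂ z∈s = inj₂ z∈s

∉-[≔] : ∀ {z x s} u → ¬ z ∈ u → ¬ z ∈ s → ¬ z ∈ u [ x ≔ s ]
∉-[≔] u z∉u z∉s z∈ with ∈-[≔]⁻ u z∈
... | inj₁ (_ , z∈u) = z∉u z∈u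
... | inj₂ z∈s = z∉s z∈s

maxVar : Comb → ℕ
maxVar (var y) = y
maxVar K = 0
maxVar S = 0
maxVar I = 0
maxVar (u · v) = maxVar u ⊔ maxVar v

∈⇒≤maxVar : ∀ {x u} → x ∈ u → x ≤ maxVar u
∈⇒≤maxVar here = ≤-refl
∈⇒≤maxVar (left {u} {v} p) = ≤-trans (∈⇒≤maxVar p) (m≤m⊔n (maxVar u) (maxVar v))
∈⇒≤maxVar (right {u} {v} p) = ≤-trans (∈⇒≤maxVar p) (m≤n⊔m (maxVar u) (maxVar v))

fresh : Comb → ℕ
fresh u = suc (maxVar u)

fresh-∉ : ∀ u → ¬ fresh u ∈ u
fresh-∉ u p = <-irrefl refl (∈⇒≤maxVar p)

[≔]-η : ∀ {x A t} → ¬ x ∈ A → (A · var x) [ x ≔ t ] ≡ A · t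
[≔]-η {x} {A} {t} x∉A = cong₂ _·_ ([≔]-∉ A x∉A) ([≔]-var-≡ x t)

-- Bracket abstraction

data ƛ-View (x : ℕ) : Comb → Set where
  const : ∀ {u} → ¬ x ∈ u → ƛ-View x u
  ident : ƛ-View x (var x)
  app   : ∀ {u v} → x ∈ u · v → ƛ-View x (u · v)

ƛ-view : ∀ x u → ƛ-View x u
ƛ-view x u with x ∈? u
... | no x∉u = const x∉u
ƛ-view x (var y) | yes here = ident
ƛ-view x (u · v) | yes x∈uv = app x∈uv

ƛ-const : ∀ {x u} → ¬ x ∈ u → ƛ x u ≡ K · u
ƛ-const x∉u rewrite occurs-∉ x∉u = refl

ƛ-ident : ∀ x → ƛ x (var x) ≡ I
ƛ-ident x rewrite occurs-∈ {x} here = refl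

ƛ-app : ∀ {x u v} → x ∈ u · v → ƛ x (u · v) ≡ S · ƛ x u · ƛ x v
ƛ-app x∈uv rewrite occurs-∈ x∈uv = refl

∉-ƛ : ∀ x u → ¬ x ∈ ƛ x u
∉-ƛ x u with ƛ-view x u
... | const x∉u rewrite ƛ-const x∉u = ∉-· (λ ()) x∉u
... | ident rewrite ƛ-ident x = λ ()
... | app {u₁} {u₂} x∈u rewrite ƛ-app x∈u = ∉-· (∉-· (λ ()) (∉-ƛ x u₁)) (∉-ƛ x u₂)

∈-ƛ⁻ : ∀ {y} x u → y ∈ ƛ x u → y ∈ u
∈-ƛ⁻ x u y∈ with ƛ-view x u
... | const x∉u rewrite ƛ-const x∉u with y∈
...   | right y∈u = y∈u
∈-ƛ⁻ x u y∈ | ident rewrite ƛ-ident x with y∈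
...   | ()
∈-ƛ⁻ x u y∈ | app {u₁} {u₂} x∈u rewrite ƛ-app x∈u with y∈
...   | left (right p) = left (∈-ƛ⁻ x u₁ p)
...   | right p = right (∈-ƛ⁻ x u₂ p)

∈-ƛ : ∀ {y x u} → y ≢ x → y ∈ u → y ∈ ƛ x u
∈-ƛ {x = x} {u} y≢x y∈u with ƛ-view x u
... | const x∉u rewrite ƛ-const x∉u = right y∈u
∈-ƛ y≢x here | ident = ⊥-elim (y≢x refl)
∈-ƛ y≢x y∈u | app x∈u rewrite ƛ-app x∈u with y∈u
... | left p = left (right (∈-ƛ y≢x p))
... | right p = right (∈-ƛ y≢x p)

ƛ-rename : ∀ {y z} u → ¬ z ∈ u → ƛ y u ≡ ƛ z (u [ y ≔ var z ])
ƛ-rename {y} {z} u z∉u with ƛ-view y u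
... | const y∉u rewrite [≔]-∉ {s = var z} u y∉u = trans (ƛ-const y∉u) (sym (ƛ-const z∉u))
... | ident rewrite [≔]-var-≡ y (var z) = trans (ƛ-ident y) (sym (ƛ-ident z))
... | app {u₁} {u₂} y∈u = begin
  ƛ y (u₁ · u₂)
    ≡⟨ ƛ-app y∈u ⟩
  S · ƛ y u₁ · ƛ y u₂
    ≡⟨ cong₂ (λ a b → S · a · b) (ƛ-rename u₁ (z∉u ∘ left)) (ƛ-rename u₂ (z∉u ∘ right)) ⟩
  S · ƛ z (u₁ [ y ≔ var z ]) · ƛ z (u₂ [ y ≔ var z ])
    ≡⟨ ƛ-app (∈-[≔]-hit y∈u here) ⟨
  ƛ z ((u₁ · u₂) [ y ≔ var z ])
    ∎
  where open ≡-Reasoning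

ƛ-rename-∉ : ∀ {x y} v → ¬ x ∈ ƛ y v → ƛ y v ≡ ƛ x (v [ y ≔ var x ])
ƛ-rename-∉ {x} {y} v x∉ƛ with x ≟ y
... | yes refl = cong (ƛ x) (sym ([≔]-id x v))
... | no x≢y = ƛ-rename v (x∉ƛ ∘ ∈-ƛ x≢y)

[≔]-ƛ : ∀ {x z s} u → z ≢ x → ¬ z ∈ s → (ƛ z u) [ x ≔ s ] ≡ ƛ z (u [ x ≔ s ])
[≔]-ƛ {z = z} {s} u z≢x z∉s with ƛ-view z u
... | const z∉u rewrite ƛ-const z∉u = sym (ƛ-const (∉-[≔] u z∉u z∉s))
... | ident rewrite ƛ-ident z | [≔]-var-≢ s (z≢x ∘ sym) = sym (ƛ-ident z)
... | app {u₁} {u₂} z∈u rewrite ƛ-app z∈u =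
  trans (cong₂ (λ a b → S · a · b) ([≔]-ƛ u₁ z≢x z∉s) ([≔]-ƛ u₂ z≢x z∉s))
        (sym (ƛ-app (∈-[≔]-≢ z≢x z∈u)))

-- Reduction

infix 4 _⇒_ _⇐_ _⇒*_ _⇒⁺_

-- ⟶ with its rule under ƛ y unfolded: for ƛ y u = K · u it is appR, for ƛ y (var y) = I there is
-- no step, and otherwise it is ξ, stated with equations because ƛ cannot occur in an index pattern.
data _⇒_ : Comb → Comb → Set where
  βK    : ∀ {u v} → K · u · v ⇒ u
  βS    : ∀ {u v w} → S · u · v · w ⇒ u · w · (v · w)
  βI    : ∀ {u} → I · u ⇒ u
  ηKK   : ∀ {u v} → S · (K · u) · (K · v) ⇒ K · (u · v)
  ηKI   : ∀ {u} → S · (K · u) · I ⇒ u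
  appL  : ∀ {u u′ v} → u ⇒ u′ → u · v ⇒ u′ · v
  appR  : ∀ {u v v′} → v ⇒ v′ → u · v ⇒ u · v′
  ξ     : ∀ {A B C y u₁ u₂ v} → A ≡ ƛ y u₁ → B ≡ ƛ y u₂ → C ≡ ƛ y v →
          y ∈ u₁ · u₂ → u₁ · u₂ ⇒ v → S · A · B ⇒ C

height : ∀ {u v} → u ⇒ v → ℕ
height (appL r) = suc (height r)
height (appR r) = suc (height r)
height (ξ _ _ _ _ r) = suc (height r)
height _ = 0

∈-⇒⁻ : ∀ {y u v} → u ⇒ v → y ∈ v → y ∈ u
∈-⇒⁻ βK p = left (right p)
∈-⇒⁻ βS (left (left p)) = left (left (right p))
∈-⇒⁻ βS (left (right p)) = right p
∈-⇒⁻ βS (right (left p)) = left (right p)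
∈-⇒⁻ βS (right (right p)) = right p
∈-⇒⁻ βI p = right p
∈-⇒⁻ ηKK (right (left p)) = left (right (right p))
∈-⇒⁻ ηKK (right (right p)) = right (right p)
∈-⇒⁻ ηKI p = left (right (right p))
∈-⇒⁻ (appL r) (left p) = left (∈-⇒⁻ r p)
∈-⇒⁻ (appL r) (right p) = right p
∈-⇒⁻ (appR r) (left p) = left p
∈-⇒⁻ (appR r) (right p) = right (∈-⇒⁻ r p)
∈-⇒⁻ {y} (ξ {y = x} {u₁} {u₂} {v} refl refl refl _ r) p with y ≟ x
... | yes refl = ⊥-elim (∉-ƛ x v p)
... | no y≢x with ∈-⇒⁻ r (∈-ƛ⁻ x v p)
...   | left q = left (right (∈-ƛ y≢x q))
...   | right q = right (∈-ƛ y≢x q)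

∉-⇒ : ∀ {y u v} → u ⇒ v → ¬ y ∈ u → ¬ y ∈ v
∉-⇒ r y∉u = y∉u ∘ ∈-⇒⁻ r

_⇐_ : Comb → Comb → Set
u ⇐ v = v ⇒ u

_⇒*_ : Comb → Comb → Set
_⇒*_ = Star _⇒_

-- Stated through _⇐_ so that Plus.accessible turns SN into accessibility for _⇒⁺_.
_⇒⁺_ : Comb → Comb → Set
u ⇒⁺ v = TransClosure _⇐_ v u

SN : Comb → Set
SN = Acc _⇐_

infixr 5 _◅⁺_ _◅◅⁺_ _⁺▻▻_

[_]⁺ : ∀ {u v} → u ⇒ v → u ⇒⁺ v
[ r ]⁺ = Plus.[ r ]

_◅⁺_ : ∀ {u v w} → u ⇒ v → v ⇒⁺ w → u ⇒⁺ w
r ◅⁺ p = p ∷ʳ r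

_◅◅⁺_ : ∀ {u v w} → u ⇒* v → v ⇒⁺ w → u ⇒⁺ w
ε ◅◅⁺ q = q
(r ◅ p) ◅◅⁺ q = r ◅⁺ (p ◅◅⁺ q)

_⁺▻▻_ : ∀ {u v w} → u ⇒⁺ v → v ⇒* w → u ⇒⁺ w
p ⁺▻▻ ε = p
p ⁺▻▻ (r ◅ q) = (r Plus.∷ p) ⁺▻▻ q

⁺⇒* : ∀ {u v} → u ⇒⁺ v → u ⇒* v
⁺⇒* Plus.[ r ] = r ◅ ε
⁺⇒* (r Plus.∷ p) = ⁺⇒* p ◅◅ (r ◅ ε)

⇒⁺-map : ∀ (f : Comb → Comb) → (∀ {a b} → a ⇒ b → f a ⇒ f b) → ∀ {u v} → u ⇒⁺ v → f u ⇒⁺ f v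
⇒⁺-map f g Plus.[ r ] = Plus.[ g r ]
⇒⁺-map f g (r Plus.∷ p) = g r Plus.∷ ⇒⁺-map f g p

appL* : ∀ {u u′ v} → u ⇒* u′ → u · v ⇒* u′ · v
appL* = gmap _ appL

appR* : ∀ {u v v′} → v ⇒* v′ → u · v ⇒* u · v′
appR* = gmap _ appR

app* : ∀ {u u′ v v′} → u ⇒* u′ → v ⇒* v′ → u · v ⇒* u′ · v′
app* p q = appL* p ◅◅ appR* q

appL⁺ : ∀ {u u′ v} → u ⇒⁺ u′ → u · v ⇒⁺ u′ · v
appL⁺ = ⇒⁺-map _ appL

appR⁺ : ∀ {u v v′} → v ⇒⁺ v′ → u · v ⇒⁺ u · v′
appR⁺ = ⇒⁺-map _ appR

ƛ-⇒ : ∀ z {u v} → u ⇒ v → ƛ z u ⇒ ƛ z v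
ƛ-⇒ z {u} {v} r with ƛ-view z u
... | const z∉u rewrite ƛ-const z∉u | ƛ-const (∉-⇒ r z∉u) = appR r
... | ident with () ← r
... | app z∈u rewrite ƛ-app z∈u = ξ refl refl refl z∈u r

ƛ-⇒⁺ : ∀ z {u v} → u ⇒⁺ v → ƛ z u ⇒⁺ ƛ z v
ƛ-⇒⁺ z = ⇒⁺-map (ƛ z) (ƛ-⇒ z)

⟶⇒⇒ : ∀ {u v} → u ⟶ v → u ⇒ v
⟶⇒⇒ βK = βK
⟶⇒⇒ βS = βS
⟶⇒⇒ βI = βI
⟶⇒⇒ ηKK = ηKK
⟶⇒⇒ ηKI = ηKI
⟶⇒⇒ (appL r) = appL (⟶⇒⇒ r)
⟶⇒⇒ (appR r) = appR (⟶⇒⇒ r)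
⟶⇒⇒ (abs {x} r) = ƛ-⇒ x (⟶⇒⇒ r)

ƛ-[≔] : ∀ {x y z s} u → ¬ z ∈ u → z ≢ x → ¬ z ∈ s →
        (ƛ y u) [ x ≔ s ] ≡ ƛ z (u [ y ≔ var z ] [ x ≔ s ])
ƛ-[≔] u z∉u z≢x z∉s = trans (cong (_[ _ ≔ _ ]) (ƛ-rename u z∉u)) ([≔]-ƛ (u [ _ ≔ var _ ]) z≢x z∉s)

-- Fuelled by the height, because the ξ case recurses on a renamed copy of the premise.
[≔]-⇒-height : ∀ n {u v} (r : u ⇒ v) → height r < n → ∀ x s →
               Σ[ r′ ∈ u [ x ≔ s ] ⇒ v [ x ≔ s ] ] height r′ ≡ height r
[≔]-⇒-height (suc n) βK _ x s = βK , refl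
[≔]-⇒-height (suc n) βS _ x s = βS , refl
[≔]-⇒-height (suc n) βI _ x s = βI , refl
[≔]-⇒-height (suc n) ηKK _ x s = ηKK , refl
[≔]-⇒-height (suc n) ηKI _ x s = ηKI , refl
[≔]-⇒-height (suc n) (appL r) (s≤s h<n) x s with [≔]-⇒-height n r h<n x s
... | r′ , eq = appL r′ , cong suc eq
[≔]-⇒-height (suc n) (appR r) (s≤s h<n) x s with [≔]-⇒-height n r h<n x s
... | r′ , eq = appR r′ , cong suc eq
[≔]-⇒-height (suc n) (ξ {y = y} {u₁} {u₂} {v} refl refl refl y∈u r) (s≤s h<n) x s =
  ξ (ƛ-[≔] u₁ (z∉ ∘ left ∘ left ∘ left ∘ left) z≢x z∉s)
    (ƛ-[≔] u₂ (z∉ ∘ left ∘ left ∘ left ∘ right) z≢x z∉s)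
    (ƛ-[≔] v (z∉ ∘ left ∘ left ∘ right) z≢x z∉s)
    (∈-[≔]-≢ z≢x (∈-[≔]-hit y∈u here)) (proj₁ substituted) ,
  cong suc (trans (proj₂ substituted) (proj₂ renamed))
  where
  z = fresh (u₁ · u₂ · v · s · var x)
  z∉ = fresh-∉ (u₁ · u₂ · v · s · var x)
  z∉s = z∉ ∘ left ∘ right
  z≢x = ∉-var (z∉ ∘ right)
  renamed = [≔]-⇒-height n r h<n y (var z)
  substituted = [≔]-⇒-height n (proj₁ renamed) (subst (_< n) (sym (proj₂ renamed)) h<n) x s

[≔]-⇒ : ∀ {u v} → u ⇒ v → ∀ x s → u [ x ≔ s ] ⇒ v [ x ≔ s ]
[≔]-⇒ r x s = proj₁ ([≔]-⇒-height _ r (n<1+n _) x s)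

[≔]-⇒⁺ : ∀ {u v} → u ⇒⁺ v → ∀ x s → u [ x ≔ s ] ⇒⁺ v [ x ≔ s ]
[≔]-⇒⁺ p x s = ⇒⁺-map (_[ x ≔ s ]) (λ r → [≔]-⇒ r x s) p

[≔]-arg-⇒* : ∀ {t t′} x u → t ⇒* t′ → u [ x ≔ t ] ⇒* u [ x ≔ t′ ]
[≔]-arg-⇒* x (var y) p with x ≟ y
... | yes _ = p
... | no _ = ε
[≔]-arg-⇒* x K p = ε
[≔]-arg-⇒* x S p = ε
[≔]-arg-⇒* x I p = ε
[≔]-arg-⇒* x (u · v) p = app* ([≔]-arg-⇒* x u p) ([≔]-arg-⇒* x v p)

[≔]-arg-⇒⁺ : ∀ {x t t′ u} → x ∈ u → t ⇒⁺ t′ → u [ x ≔ t ] ⇒⁺ u [ x ≔ t′ ]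
[≔]-arg-⇒⁺ {x} {t} {t′} here p rewrite [≔]-var-≡ x t | [≔]-var-≡ x t′ = p
[≔]-arg-⇒⁺ {x} (left {v = v} q) p = appL⁺ ([≔]-arg-⇒⁺ q p) ⁺▻▻ appR* ([≔]-arg-⇒* x v (⁺⇒* p))
[≔]-arg-⇒⁺ {x} (right {u} q) p = appR⁺ ([≔]-arg-⇒⁺ q p) ⁺▻▻ appL* ([≔]-arg-⇒* x u (⁺⇒* p))

ƛ-β : ∀ y u t → ƛ y u · t ⇒* u [ y ≔ t ]
ƛ-β y u t with ƛ-view y u
... | const y∉u rewrite ƛ-const y∉u | [≔]-∉ {s = t} u y∉u = βK ◅ ε
... | ident rewrite ƛ-ident y | [≔]-var-≡ y t = βI ◅ ε
... | app {u₁} {u₂} y∈u rewrite ƛ-app y∈u = βS ◅ app* (ƛ-β y u₁ t) (ƛ-β y u₂ t)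

-- Abstractions

-- Abs x A w: A · t ⇒* w [ x ≔ t ]. The η form lets an arbitrary term be a component of an
-- S-abstraction; only proper abstractions are contracted by marks.
mutual
  data ProperAbs (x : ℕ) : Comb → Comb → Set where
    K-abs : ∀ {w} → ¬ x ∈ w → ProperAbs x (K · w) w
    I-abs : ProperAbs x I (var x)
    S-abs : ∀ {A₁ A₂ w₁ w₂} → Abs x A₁ w₁ → Abs x A₂ w₂ → ProperAbs x (S · A₁ · A₂) (w₁ · w₂)

  data Abs (x : ℕ) : Comb → Comb → Set where
    proper : ∀ {A w} → ProperAbs x A w → Abs x A w
    η-abs  : ∀ {A} → ¬ x ∈ A → Abs x A (A · var x)

-- One unit per head step of A · t, plus the weight m of the argument's expansion for every copy
-- of the argument that survives.
mutual
  weightₚ : ∀ {x A w} → ProperAbs x A w → ℕ → ℕ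
  weightₚ (K-abs _) m = 1
  weightₚ I-abs m = suc m
  weightₚ (S-abs a₁ a₂) m = suc (weightₐ a₁ m + weightₐ a₂ m)

  weightₐ : ∀ {x A w} → Abs x A w → ℕ → ℕ
  weightₐ (proper p) m = weightₚ p m
  weightₐ (η-abs _) m = m

mutual
  weightₚ-mono : ∀ {x A w} (p : ProperAbs x A w) {m n} → m ≤ n → weightₚ p m ≤ weightₚ p n
  weightₚ-mono (K-abs _) m≤n = ≤-refl
  weightₚ-mono I-abs m≤n = s≤s m≤n
  weightₚ-mono (S-abs a₁ a₂) m≤n = s≤s (+-mono-≤ (weightₐ-mono a₁ m≤n) (weightₐ-mono a₂ m≤n))

  weightₐ-mono : ∀ {x A w} (a : Abs x A w) {m n} → m ≤ n → weightₐ a m ≤ weightₐ a n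
  weightₐ-mono (proper p) = weightₚ-mono p
  weightₐ-mono (η-abs _) m≤n = m≤n

mutual
  weightₚ-strict : ∀ {x A w} (p : ProperAbs x A w) {m n} → x ∈ w → m < n → weightₚ p m < weightₚ p n
  weightₚ-strict (K-abs x∉w) x∈w = ⊥-elim (x∉w x∈w)
  weightₚ-strict I-abs _ m<n = s≤s m<n
  weightₚ-strict (S-abs a₁ a₂) (left x∈w₁) m<n =
    s≤s (+-mono-<-≤ (weightₐ-strict a₁ x∈w₁ m<n) (weightₐ-mono a₂ (<⇒≤ m<n)))
  weightₚ-strict (S-abs a₁ a₂) (right x∈w₂) m<n =
    s≤s (+-mono-≤-< (weightₐ-mono a₁ (<⇒≤ m<n)) (weightₐ-strict a₂ x∈w₂ m<n))

  weightₐ-strict : ∀ {x A w} (a : Abs x A w) {m n} → x ∈ w → m < n → weightₐ a m < weightₐ a n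
  weightₐ-strict (proper p) = weightₚ-strict p
  weightₐ-strict (η-abs _) _ m<n = m<n

mutual
  weightₚ-const : ∀ {x A w} (p : ProperAbs x A w) m n → ¬ x ∈ w → weightₚ p m ≡ weightₚ p n
  weightₚ-const (K-abs _) m n _ = refl
  weightₚ-const I-abs m n x∉x = ⊥-elim (x∉x here)
  weightₚ-const (S-abs a₁ a₂) m n x∉w =
    cong suc (cong₂ _+_ (weightₐ-const a₁ m n (x∉w ∘ left)) (weightₐ-const a₂ m n (x∉w ∘ right)))

  weightₐ-const : ∀ {x A w} (a : Abs x A w) m n → ¬ x ∈ w → weightₐ a m ≡ weightₐ a n
  weightₐ-const (proper p) = weightₚ-const p
  weightₐ-const (η-abs _) m n x∉w = ⊥-elim (x∉w (right here))

mutual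
  properAbs-∉ : ∀ {x A w} → ProperAbs x A w → ¬ x ∈ A
  properAbs-∉ (K-abs x∉w) = ∉-· (λ ()) x∉w
  properAbs-∉ I-abs = λ ()
  properAbs-∉ (S-abs a₁ a₂) = ∉-· (∉-· (λ ()) (abs-∉ a₁)) (abs-∉ a₂)

  abs-∉ : ∀ {x A w} → Abs x A w → ¬ x ∈ A
  abs-∉ (proper p) = properAbs-∉ p
  abs-∉ (η-abs x∉A) = x∉A

mutual
  ∈-properAbs⁻ : ∀ {x y A w} → ProperAbs x A w → y ∈ w → y ≡ x ⊎ y ∈ A
  ∈-properAbs⁻ (K-abs _) y∈w = inj₂ (right y∈w)
  ∈-properAbs⁻ I-abs here = inj₁ refl
  ∈-properAbs⁻ (S-abs a₁ a₂) (left y∈w₁) with ∈-abs⁻ a₁ y∈w₁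
  ... | inj₁ y≡x = inj₁ y≡x
  ... | inj₂ y∈A₁ = inj₂ (left (right y∈A₁))
  ∈-properAbs⁻ (S-abs a₁ a₂) (right y∈w₂) with ∈-abs⁻ a₂ y∈w₂
  ... | inj₁ y≡x = inj₁ y≡x
  ... | inj₂ y∈A₂ = inj₂ (right y∈A₂)

  ∈-abs⁻ : ∀ {x y A w} → Abs x A w → y ∈ w → y ≡ x ⊎ y ∈ A
  ∈-abs⁻ (proper p) = ∈-properAbs⁻ p
  ∈-abs⁻ (η-abs _) (left y∈A) = inj₂ y∈A
  ∈-abs⁻ (η-abs _) (right here) = inj₁ refl

ƛ-properAbs : ∀ x w → ProperAbs x (ƛ x w) w
ƛ-properAbs x w with ƛ-view x w
... | const x∉w = subst (λ A → ProperAbs x A w) (sym (ƛ-const x∉w)) (K-abs x∉w)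
... | ident = subst (λ A → ProperAbs x A (var x)) (sym (ƛ-ident x)) I-abs
... | app {w₁} {w₂} x∈w = subst (λ A → ProperAbs x A (w₁ · w₂)) (sym (ƛ-app x∈w))
                            (S-abs (proper (ƛ-properAbs x w₁)) (proper (ƛ-properAbs x w₂)))

abs-ƛ-⇒* : ∀ {x y A w} u → A ≡ ƛ y u → Abs x A w → w ⇒* u [ y ≔ var x ]
abs-ƛ-⇒* {x} {y} u refl a with ƛ-view y u
... | const y∉u rewrite ƛ-const y∉u | [≔]-∉ {s = var x} u y∉u = fromK a
  where
  fromK : ∀ {w} → Abs x (K · u) w → w ⇒* u
  fromK (proper (K-abs _)) = ε
  fromK (η-abs _) = βK ◅ ε
... | ident rewrite ƛ-ident y | [≔]-var-≡ y (var x) = fromI a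
  where
  fromI : ∀ {w} → Abs x I w → w ⇒* var x
  fromI (proper I-abs) = ε
  fromI (η-abs _) = βI ◅ ε
... | app {u₁} {u₂} y∈u rewrite ƛ-app y∈u = fromS a
  where
  fromS : ∀ {w} → Abs x (S · ƛ y u₁ · ƛ y u₂) w → w ⇒* (u₁ · u₂) [ y ≔ var x ]
  fromS (proper (S-abs a₁ a₂)) = app* (abs-ƛ-⇒* u₁ refl a₁) (abs-ƛ-⇒* u₂ refl a₂)
  fromS (η-abs _) = subst (λ B → B · var x ⇒* (u₁ · u₂) [ y ≔ var x ]) (ƛ-app y∈u) (ƛ-β y (u₁ · u₂) (var x))

data AbsReduct (x : ℕ) (A′ w : Comb) (W : ℕ → ℕ) : Set where
  reduced : ∀ {w′} → Abs x A′ w′ → w ⇒⁺ w′ → AbsReduct x A′ w W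
  lighter : (a : Abs x A′ w) → (∀ m → weightₐ a m < W m) → AbsReduct x A′ w W

mutual
  properAbs-⇒ : ∀ {x A A′ w} (p : ProperAbs x A w) → A ⇒ A′ → AbsReduct x A′ w (weightₚ p)
  properAbs-⇒ (K-abs x∉w) (appR r) = reduced (proper (K-abs (∉-⇒ r x∉w))) [ r ]⁺
  properAbs-⇒ (S-abs a₁ a₂) (appL (appR r)) with abs-⇒ a₁ r
  ... | reduced a₁′ p = reduced (proper (S-abs a₁′ a₂)) (appL⁺ p)
  ... | lighter a₁′ lt = lighter (proper (S-abs a₁′ a₂)) λ m → s≤s (+-monoˡ-< (weightₐ a₂ m) (lt m))
  properAbs-⇒ (S-abs a₁ a₂) (appR r) with abs-⇒ a₂ r
  ... | reduced a₂′ p = reduced (proper (S-abs a₁ a₂′)) (appR⁺ p)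
  ... | lighter a₂′ lt = lighter (proper (S-abs a₁ a₂′)) λ m → s≤s (+-monoʳ-< (weightₐ a₁ m) (lt m))
  properAbs-⇒ (S-abs (proper (K-abs x∉u)) (proper (K-abs x∉v))) ηKK =
    lighter (proper (K-abs (∉-· x∉u x∉v))) λ m → s≤s (s≤s z≤n)
  properAbs-⇒ (S-abs (proper (K-abs x∉u)) (η-abs x∉Kv)) ηKK =
    reduced (proper (K-abs (∉-· x∉u (x∉Kv ∘ right)))) [ appR βK ]⁺
  properAbs-⇒ (S-abs (η-abs x∉Ku) (proper (K-abs x∉v))) ηKK =
    reduced (proper (K-abs (∉-· (x∉Ku ∘ right) x∉v))) [ appL βK ]⁺
  properAbs-⇒ (S-abs (η-abs x∉Ku) (η-abs x∉Kv)) ηKK =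
    reduced (proper (K-abs (∉-· (x∉Ku ∘ right) (x∉Kv ∘ right)))) (appL βK ◅⁺ [ appR βK ]⁺)
  properAbs-⇒ (S-abs (proper (K-abs x∉u)) (proper I-abs)) ηKI =
    lighter (η-abs x∉u) λ m → s≤s (m≤n+m m 2)
  properAbs-⇒ (S-abs (proper (K-abs x∉u)) (η-abs _)) ηKI = reduced (η-abs x∉u) [ appR βI ]⁺
  properAbs-⇒ (S-abs (η-abs x∉Ku) (proper I-abs)) ηKI = reduced (η-abs (x∉Ku ∘ right)) [ appL βK ]⁺
  properAbs-⇒ (S-abs (η-abs x∉Ku) (η-abs _)) ηKI =
    reduced (η-abs (x∉Ku ∘ right)) (appL βK ◅⁺ [ appR βI ]⁺)
  properAbs-⇒ {x} p@(S-abs a₁ a₂) r@(ξ {y = y} {u₁} {u₂} {v} A≡ B≡ refl _ r₀) =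
    reduced (subst (λ C → Abs x C (v [ y ≔ var x ])) (sym (ƛ-rename-∉ v (∉-⇒ r (properAbs-∉ p))))
                   (proper (ƛ-properAbs x _)))
            (app* (abs-ƛ-⇒* u₁ A≡ a₁) (abs-ƛ-⇒* u₂ B≡ a₂) ◅◅⁺ [ [≔]-⇒ r₀ _ (var x) ]⁺)

  abs-⇒ : ∀ {x A A′ w} (a : Abs x A w) → A ⇒ A′ → AbsReduct x A′ w (weightₐ a)
  abs-⇒ (proper p) r = properAbs-⇒ p r
  abs-⇒ (η-abs x∉A) r = reduced (η-abs (∉-⇒ r x∉A)) [ appL r ]⁺

-- Marked expansions

data Atom : Comb → Set where
  var : ∀ x → Atom (var x)
  K : Atom K
  S : Atom S
  I : Atom I

SNTerm : Set
SNTerm = Σ[ t ∈ Comb ] SN t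

Avoids : List ℕ → Comb → Set
Avoids zs u = All (λ z → ¬ z ∈ u) zs

avoids-·ˡ : ∀ {zs u v} → Avoids zs (u · v) → Avoids zs u
avoids-·ˡ = All.map (_∘ left)

avoids-·ʳ : ∀ {zs u v} → Avoids zs (u · v) → Avoids zs v
avoids-·ʳ = All.map (_∘ right)

avoids-· : ∀ {zs u v} → Avoids zs u → Avoids zs v → Avoids zs (u · v)
avoids-· p q = All.zipWith (λ (z∉u , z∉v) → ∉-· z∉u z∉v) (p , q)

avoids-⇒ : ∀ {zs u v} → u ⇒ v → Avoids zs u → Avoids zs v
avoids-⇒ r = All.map (∉-⇒ r)

avoids-⇒ˡ : ∀ {zs A A′ t} → A ⇒ A′ → Avoids zs (A · t) → Avoids zs (A′ · t)
avoids-⇒ˡ r av = avoids-· (avoids-⇒ r (avoids-·ˡ av)) (avoids-·ʳ av)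

avoids-⇒ʳ : ∀ {zs A t t₁} → t ⇒ t₁ → Avoids zs (A · t) → Avoids zs (A · t₁)
avoids-⇒ʳ r av = avoids-· (avoids-·ˡ av) (avoids-⇒ r (avoids-·ʳ av))

-- zs ⊢ s ⊵ s′: s′ arises from s by contracting marked redexes A · t to w [ x ≔ t′ ], where A
-- abstracts x from w, t is strongly normalizing and expands to t′; no mark contains a variable of zs.
infix 3 _⊢_⊵_

data _⊢_⊵_ (zs : List ℕ) : Comb → Comb → Set where
  ⊵-atom : ∀ {a} → Atom a → zs ⊢ a ⊵ a
  ⊵-·    : ∀ {a a′ b b′} → zs ⊢ a ⊵ a′ → zs ⊢ b ⊵ b′ → zs ⊢ a · b ⊵ a′ · b′
  ⊵-mark : ∀ {x A w t t′ s′} → ProperAbs x A w → Avoids zs (A · t) → SN t → zs ⊢ t ⊵ t′ →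
           s′ ≡ w [ x ≔ t′ ] → zs ⊢ A · t ⊵ s′

⊵-refl : ∀ {zs} s → zs ⊢ s ⊵ s
⊵-refl (var x) = ⊵-atom (var x)
⊵-refl K = ⊵-atom K
⊵-refl S = ⊵-atom S
⊵-refl I = ⊵-atom I
⊵-refl (u · v) = ⊵-· (⊵-refl u) (⊵-refl v)

weight : ∀ {zs s s′} → zs ⊢ s ⊵ s′ → ℕ
weight (⊵-atom _) = 0
weight (⊵-· d e) = weight d + weight e
weight (⊵-mark p _ _ dt _) = weightₚ p (weight dt)

-- The arguments of marks that discard them: their reductions are invisible in the target.
erased : ∀ {zs s s′} → zs ⊢ s ⊵ s′ → List SNTerm
erased (⊵-atom _) = []
erased (⊵-· d e) = erased d ++ erased e
erased (⊵-mark {x} {w = w} {t} p _ t-sn dt _) =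
  if does (x ∈? w) then erased dt else (t , t-sn) ∷ []

erased-⊵-mark-∈ : ∀ {zs x A w t t′ s′} (p : ProperAbs x A w) (av : Avoids zs (A · t)) (t-sn : SN t)
                  (dt : zs ⊢ t ⊵ t′) (eq : s′ ≡ w [ x ≔ t′ ]) → x ∈ w →
                  erased (⊵-mark p av t-sn dt eq) ≡ erased dt
erased-⊵-mark-∈ {x = x} {w = w} _ _ _ _ _ x∈w = cong (if_then _ else _) (dec-true (x ∈? w) x∈w)

erased-⊵-mark-∉ : ∀ {zs x A w t t′ s′} (p : ProperAbs x A w) (av : Avoids zs (A · t)) (t-sn : SN t)
                  (dt : zs ⊢ t ⊵ t′) (eq : s′ ≡ w [ x ≔ t′ ]) → ¬ x ∈ w →
                  erased (⊵-mark p av t-sn dt eq) ≡ (t , t-sn) ∷ []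
erased-⊵-mark-∉ {x = x} {w = w} _ _ _ _ _ x∉w = cong (if_then _ else _) (dec-false (x ∈? w) x∉w)

weight-⊵-refl : ∀ {zs} s → weight (⊵-refl {zs} s) ≡ 0
weight-⊵-refl (var x) = refl
weight-⊵-refl K = refl
weight-⊵-refl S = refl
weight-⊵-refl I = refl
weight-⊵-refl (u · v) = cong₂ _+_ (weight-⊵-refl u) (weight-⊵-refl v)

infix 4 _≈_

record _≈_ {zs s s′ zs₁ s₁ s₁′} (d : zs ⊢ s ⊵ s′) (e : zs₁ ⊢ s₁ ⊵ s₁′) : Set where
  constructor same
  field
    same-weight : weight d ≡ weight e
    same-erased : erased d ≡ erased e

≈-· : ∀ {zs zs₁ a a′ b b′ c c′ e e′} {d₁ : zs ⊢ a ⊵ a′} {d₂ : zs ⊢ b ⊵ b′}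
      {e₁ : zs₁ ⊢ c ⊵ c′} {e₂ : zs₁ ⊢ e ⊵ e′} → d₁ ≈ e₁ → d₂ ≈ e₂ → ⊵-· d₁ d₂ ≈ ⊵-· e₁ e₂
≈-· (same w₁ e₁) (same w₂ e₂) = same (cong₂ _+_ w₁ w₂) (cong₂ _++_ e₁ e₂)

≈-mark : ∀ {zs zs₁ x A w t t′ t₁′ s′ s₁′} (p : ProperAbs x A w)
         {av : Avoids zs (A · t)} {av₁ : Avoids zs₁ (A · t)} {t-sn : SN t}
         {dt : zs ⊢ t ⊵ t′} {dt₁ : zs₁ ⊢ t ⊵ t₁′} {eq : s′ ≡ w [ x ≔ t′ ]} {eq₁ : s₁′ ≡ w [ x ≔ t₁′ ]} →
         dt ≈ dt₁ → ⊵-mark p av t-sn dt eq ≈ ⊵-mark p av₁ t-sn dt₁ eq₁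
≈-mark {x = x} {w = w} p (same w≡ e≡) =
  same (cong (weightₚ p) w≡) (cong (λ l → if does (x ∈? w) then l else _) e≡)

≈-atom-·ˡ : ∀ {zs zs₁ a b b′ s s′} (α : Atom a) {d : zs ⊢ b ⊵ b′} {e : zs₁ ⊢ s ⊵ s′} →
            d ≈ e → ⊵-· (⊵-atom α) d ≈ e
≈-atom-·ˡ _ (same w≡ e≡) = same w≡ e≡

≈-atom-·ʳ : ∀ {zs zs₁ a b b′ s s′} (α : Atom a) {d : zs ⊢ s ⊵ s′} {e : zs₁ ⊢ b ⊵ b′} →
            d ≈ e → d ≈ ⊵-· (⊵-atom α) e
≈-atom-·ʳ _ (same w≡ e≡) = same w≡ e≡

∈-⊵⁻ : ∀ {zs s s′ y} → zs ⊢ s ⊵ s′ → y ∈ s′ → y ∈ s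
∈-⊵⁻ (⊵-atom _) p = p
∈-⊵⁻ (⊵-· d e) (left p) = left (∈-⊵⁻ d p)
∈-⊵⁻ (⊵-· d e) (right p) = right (∈-⊵⁻ e p)
∈-⊵⁻ (⊵-mark {w = w} a _ _ dt refl) p with ∈-[≔]⁻ w p
... | inj₂ y∈t′ = right (∈-⊵⁻ dt y∈t′)
... | inj₁ (y≢x , y∈w) with ∈-properAbs⁻ a y∈w
...   | inj₁ y≡x = ⊥-elim (y≢x y≡x)
...   | inj₂ y∈A = left y∈A

∉-⊵ : ∀ {zs s s′ y} → zs ⊢ s ⊵ s′ → ¬ y ∈ s → ¬ y ∈ s′
∉-⊵ d y∉s = y∉s ∘ ∈-⊵⁻ d

∈-⊵ : ∀ {z zs s s′} → z ∷ zs ⊢ s ⊵ s′ → z ∈ s → z ∈ s′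
∈-⊵ (⊵-atom _) p = p
∈-⊵ (⊵-· d e) (left p) = left (∈-⊵ d p)
∈-⊵ (⊵-· d e) (right p) = right (∈-⊵ e p)
∈-⊵ (⊵-mark _ (z∉ ∷ _) _ _ _) p = ⊥-elim (z∉ p)

weaken : ∀ {z zs s s′} → z ∷ zs ⊢ s ⊵ s′ → zs ⊢ s ⊵ s′
weaken (⊵-atom a) = ⊵-atom a
weaken (⊵-· d e) = ⊵-· (weaken d) (weaken e)
weaken (⊵-mark p (_ ∷ av) t-sn dt eq) = ⊵-mark p av t-sn (weaken dt) eq

weaken-≈ : ∀ {z zs s s′} (d : z ∷ zs ⊢ s ⊵ s′) → weaken d ≈ d
weaken-≈ (⊵-atom a) = same refl refl
weaken-≈ (⊵-· d e) = ≈-· (weaken-≈ d) (weaken-≈ e)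
weaken-≈ (⊵-mark p (_ ∷ av) t-sn dt eq) = ≈-mark p (weaken-≈ dt)

strengthen : ∀ {z zs s s′} → ¬ z ∈ s → zs ⊢ s ⊵ s′ → z ∷ zs ⊢ s ⊵ s′
strengthen z∉ (⊵-atom a) = ⊵-atom a
strengthen z∉ (⊵-· d e) = ⊵-· (strengthen (z∉ ∘ left) d) (strengthen (z∉ ∘ right) e)
strengthen z∉ (⊵-mark p av t-sn dt eq) = ⊵-mark p (z∉ ∷ av) t-sn (strengthen (z∉ ∘ right) dt) eq

strengthen-≈ : ∀ {z zs s s′} (z∉ : ¬ z ∈ s) (d : zs ⊢ s ⊵ s′) → strengthen z∉ d ≈ d
strengthen-≈ z∉ (⊵-atom a) = same refl refl
strengthen-≈ z∉ (⊵-· d e) = ≈-· (strengthen-≈ _ d) (strengthen-≈ _ e)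
strengthen-≈ z∉ (⊵-mark p av t-sn dt eq) = ≈-mark p (strengthen-≈ (z∉ ∘ right) dt)

-- Simulation

infix 4 _◁_

data _◁_ : List SNTerm → List SNTerm → Set where
  here  : ∀ {t t₁ l} {rs : WfRec _⇐_ SN t} (r : t ⇒ t₁) → (t₁ , rs r) ∷ l ◁ (t , acc rs) ∷ l
  there : ∀ {e l l₁} → l₁ ◁ l → e ∷ l₁ ◁ e ∷ l

◁-acc-∷ : ∀ {t} (t-sn : SN t) {l} → Acc _◁_ l → Acc _◁_ ((t , t-sn) ∷ l)
◁-acc-∷ t-sn@(acc rs) l-acc@(acc rl) = acc λ where
  (here r) → ◁-acc-∷ (rs r) l-acc
  (there q) → ◁-acc-∷ t-sn (rl q)

◁-wellFounded : WellFounded _◁_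
◁-wellFounded [] = acc λ ()
◁-wellFounded ((t , t-sn) ∷ l) = ◁-acc-∷ t-sn (◁-wellFounded l)

◁-++ʳ : ∀ {l₁ l₂} l → l₁ ◁ l₂ → l₁ ++ l ◁ l₂ ++ l
◁-++ʳ l (here r) = here r
◁-++ʳ l (there q) = there (◁-++ʳ l q)

◁-++ˡ : ∀ {l₁ l₂} l → l₁ ◁ l₂ → l ++ l₁ ◁ l ++ l₂
◁-++ˡ [] q = q
◁-++ˡ (e ∷ l) q = there (◁-++ˡ l q)

infix 4 _≺_

data _≺_ {zs s₁ s₁′ s s′} (d₁ : zs ⊢ s₁ ⊵ s₁′) (d : zs ⊢ s ⊵ s′) : Set where
  by-reduction : s′ ⇒⁺ s₁′ → d₁ ≺ d
  by-weight    : s₁′ ≡ s′ → weight d₁ < weight d → d₁ ≺ d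
  by-erased    : s₁′ ≡ s′ → weight d₁ ≡ weight d → erased d₁ ◁ erased d → d₁ ≺ d

≺-·ˡ : ∀ {zs a a₁ a′ a₁′ b b′} {d₁ : zs ⊢ a₁ ⊵ a₁′} {d : zs ⊢ a ⊵ a′} (e : zs ⊢ b ⊵ b′) →
       d₁ ≺ d → ⊵-· d₁ e ≺ ⊵-· d e
≺-·ˡ e (by-reduction p) = by-reduction (appL⁺ p)
≺-·ˡ e (by-weight refl lt) = by-weight refl (+-monoˡ-< (weight e) lt)
≺-·ˡ e (by-erased refl w≡ q) = by-erased refl (cong (_+ weight e) w≡) (◁-++ʳ (erased e) q)

≺-·ʳ : ∀ {zs a a′ b b₁ b′ b₁′} (e : zs ⊢ a ⊵ a′) {d₁ : zs ⊢ b₁ ⊵ b₁′} {d : zs ⊢ b ⊵ b′} →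
       d₁ ≺ d → ⊵-· e d₁ ≺ ⊵-· e d
≺-·ʳ e (by-reduction p) = by-reduction (appR⁺ p)
≺-·ʳ e (by-weight refl lt) = by-weight refl (+-monoʳ-< (weight e) lt)
≺-·ʳ e (by-erased refl w≡ q) = by-erased refl (cong (weight e +_) w≡) (◁-++ˡ (erased e) q)

data Simulated {zs s s′} (d : zs ⊢ s ⊵ s′) (s₁ : Comb) : Set where
  simulated : ∀ {s₁′} (d₁ : zs ⊢ s₁ ⊵ s₁′) → d₁ ≺ d → Simulated d s₁

data Decomposition {zs s s′} (z : ℕ) (u : Comb) (d : zs ⊢ s ⊵ s′) : Set where
  decomposed : ∀ {m} → s′ ≡ ƛ z m → (c : z ∷ zs ⊢ u ⊵ m) → c ≈ d → Decomposition z u d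

ƛ-⊵⁻ : ∀ {zs z u s s′} → s ≡ ƛ z u → (d : zs ⊢ s ⊵ s′) → Decomposition z u d
ƛ-⊵⁻ {z = z} {u} s≡ d with ƛ-view z u
... | const z∉u with refl ← trans s≡ (ƛ-const z∉u) = const-case d
  where
  const-case : ∀ {s′} (d : _ ⊢ K · u ⊵ s′) → Decomposition z u d
  const-case (⊵-· (⊵-atom K) d) =
    decomposed (sym (ƛ-const (∉-⊵ d z∉u))) (strengthen z∉u d) (≈-atom-·ʳ K (strengthen-≈ z∉u d))
  const-case (⊵-mark () _ _ _ _)
... | ident with refl ← trans s≡ (ƛ-ident z) = ident-case d
  where
  ident-case : ∀ {s′} (d : _ ⊢ I ⊵ s′) → Decomposition z (var z) d
  ident-case (⊵-atom I) = decomposed (sym (ƛ-ident z)) (⊵-atom (var z)) (same refl refl)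
... | app {u₁} {u₂} z∈u with refl ← trans s≡ (ƛ-app z∈u) = app-case d
  where
  app-case : ∀ {s′} (d : _ ⊢ S · ƛ z u₁ · ƛ z u₂ ⊵ s′) → Decomposition z (u₁ · u₂) d
  app-case (⊵-· (⊵-· (⊵-atom S) d₁) d₂) with ƛ-⊵⁻ refl d₁ | ƛ-⊵⁻ refl d₂
  ... | decomposed refl c₁ c₁≈ | decomposed refl c₂ c₂≈ =
    decomposed (sym (ƛ-app (∈-⊵ (⊵-· c₁ c₂) z∈u))) (⊵-· c₁ c₂) (≈-· (≈-atom-·ʳ S c₁≈) c₂≈)
  app-case (⊵-· (⊵-mark () _ _ _ _) _)
  app-case (⊵-mark () _ _ _ _)

ƛ-⊵ : ∀ {zs z u m s s′} → s ≡ ƛ z u → s′ ≡ ƛ z m → (c : z ∷ zs ⊢ u ⊵ m) → Σ[ d ∈ zs ⊢ s ⊵ s′ ] d ≈ c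
ƛ-⊵ {z = z} {u} s≡ s′≡ c with ƛ-view z u
... | const z∉u with refl ← trans s≡ (ƛ-const z∉u) | refl ← trans s′≡ (ƛ-const (∉-⊵ c z∉u)) =
  ⊵-· (⊵-atom K) (weaken c) , ≈-atom-·ˡ K (weaken-≈ c)
... | ident = ident-case s′≡ c
  where
  ident-case : ∀ {m s′} → s′ ≡ ƛ z m → (c : z ∷ _ ⊢ var z ⊵ m) → Σ[ d ∈ _ ⊢ _ ⊵ s′ ] d ≈ c
  ident-case s′≡ (⊵-atom (var z))
    with refl ← trans s≡ (ƛ-ident z) | refl ← trans s′≡ (ƛ-ident z) = ⊵-atom I , same refl refl
... | app {u₁} {u₂} z∈u = app-case s′≡ c
  where
  app-case : ∀ {m s′} → s′ ≡ ƛ z m → (c : z ∷ _ ⊢ u₁ · u₂ ⊵ m) → Σ[ d ∈ _ ⊢ _ ⊵ s′ ] d ≈ c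
  app-case s′≡ c@(⊵-· c₁ c₂)
    with refl ← trans s≡ (ƛ-app z∈u) | refl ← trans s′≡ (ƛ-app (∈-⊵ c z∈u))
    with ƛ-⊵ refl refl c₁ | ƛ-⊵ refl refl c₂
  ... | d₁ , d₁≈ | d₂ , d₂≈ = ⊵-· (⊵-· (⊵-atom S) d₁) d₂ , ≈-· (≈-atom-·ˡ S d₁≈) d₂≈
  app-case _ (⊵-mark _ (z∉ ∷ _) _ _ _) = ⊥-elim (z∉ z∈u)

abs-⊵ : ∀ {zs x A w t t′ s′} (a : Abs x A w) → Avoids zs (A · t) → SN t → (dt : zs ⊢ t ⊵ t′) →
        s′ ≡ w [ x ≔ t′ ] → Σ[ d ∈ zs ⊢ A · t ⊵ s′ ] weight d ≡ weightₐ a (weight dt)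
abs-⊵ (proper p) av t-sn dt eq = ⊵-mark p av t-sn dt eq , refl
abs-⊵ {A = A} (η-abs x∉A) _ _ dt eq
  with refl ← trans eq ([≔]-η x∉A) =
  ⊵-· (⊵-refl A) dt , cong (_+ weight dt) (weight-⊵-refl A)

simulate-mark-head : ∀ {zs x A A′ w t t′} (p : ProperAbs x A w) (av : Avoids zs (A · t)) (t-sn : SN t)
                     (dt : zs ⊢ t ⊵ t′) → A ⇒ A′ → Simulated (⊵-mark p av t-sn dt refl) (A′ · t)
simulate-mark-head {x = x} {t′ = t′} p av t-sn dt r with properAbs-⇒ p r
... | reduced a p⁺ = simulated (proj₁ (abs-⊵ a (avoids-⇒ˡ r av) t-sn dt refl)) (by-reduction ([≔]-⇒⁺ p⁺ x t′))
... | lighter a lt with abs-⊵ a (avoids-⇒ˡ r av) t-sn dt refl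
...   | d₁ , w≡ = simulated d₁ (by-weight refl (subst (_< weightₚ p (weight dt)) (sym w≡) (lt (weight dt))))

simulate-mark-arg : ∀ {zs x A w t t₁ t′} (p : ProperAbs x A w) (av : Avoids zs (A · t)) {rs : WfRec _⇐_ SN t}
                    (r : t ⇒ t₁) (dt : zs ⊢ t ⊵ t′) → Simulated dt t₁ →
                    Simulated (⊵-mark p av (acc rs) dt refl) (A · t₁)
simulate-mark-arg {x = x} {w = w} p av {rs} r dt (simulated dt₁ dt₁≺dt) =
  simulated (⊵-mark p av₁ (rs r) dt₁ refl) (descent (x ∈? w) dt₁≺dt)
  where
  av₁ = avoids-⇒ʳ r av

  descent : Dec (x ∈ w) → dt₁ ≺ dt → ⊵-mark p av₁ (rs r) dt₁ refl ≺ ⊵-mark p av (acc rs) dt refl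
  descent (yes x∈w) (by-reduction p⁺) = by-reduction ([≔]-arg-⇒⁺ x∈w p⁺)
  descent (yes x∈w) (by-weight refl lt) = by-weight refl (weightₚ-strict p x∈w lt)
  descent (yes x∈w) (by-erased refl w≡ q) =
    by-erased refl (cong (weightₚ p) w≡)
      (subst₂ _◁_ (sym (erased-⊵-mark-∈ p av₁ (rs r) dt₁ refl x∈w))
                  (sym (erased-⊵-mark-∈ p av (acc rs) dt refl x∈w)) q)
  descent (no x∉w) _ =
    by-erased (trans ([≔]-∉ w x∉w) (sym ([≔]-∉ w x∉w))) (weightₚ-const p _ _ x∉w)
      (subst₂ _◁_ (sym (erased-⊵-mark-∉ p av₁ (rs r) dt₁ refl x∉w))
                  (sym (erased-⊵-mark-∉ p av (acc rs) dt refl x∉w)) (here r))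

simulate-ƛ : ∀ {zs z u u₁ s s′} → s ≡ ƛ z u → (∀ {m} (c : z ∷ zs ⊢ u ⊵ m) → Simulated c u₁) →
             (d : zs ⊢ s ⊵ s′) → Simulated d (ƛ z u₁)
simulate-ƛ {z = z} s≡ simulate-body d with ƛ-⊵⁻ s≡ d
... | decomposed refl c (same cw ce) with simulate-body c
...   | simulated c₁ c₁≺c with ƛ-⊵ refl refl c₁
...     | d₁ , same dw de = simulated d₁ (descent c₁≺c)
  where
  descent : c₁ ≺ c → d₁ ≺ d
  descent (by-reduction p) = by-reduction (ƛ-⇒⁺ z p)
  descent (by-weight refl lt) = by-weight refl (subst₂ _<_ (sym dw) cw lt)
  descent (by-erased refl w≡ q) = by-erased refl (trans dw (trans w≡ cw)) (subst₂ _◁_ (sym de) ce q)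

simulate : ∀ {zs s s₁ s′} → s ⇒ s₁ → (d : zs ⊢ s ⊵ s′) → Simulated d s₁
simulate βK (⊵-· (⊵-· (⊵-atom K) du) _) = simulated du (by-reduction [ βK ]⁺)
simulate (βK {u}) (⊵-mark (K-abs x∉u) _ _ _ refl) =
  simulated (⊵-refl u) (by-weight (sym ([≔]-∉ u x∉u)) (subst (_< 1) (sym (weight-⊵-refl u)) (s≤s z≤n)))
simulate βS (⊵-· (⊵-· (⊵-· (⊵-atom S) du) dv) dw) =
  simulated (⊵-· (⊵-· du dw) (⊵-· dv dw)) (by-reduction [ βS ]⁺)
simulate βS (⊵-mark (S-abs a₁ a₂) av t-sn dt refl)
  with abs-⊵ a₁ (avoids-· (avoids-·ʳ (avoids-·ˡ (avoids-·ˡ av))) (avoids-·ʳ av)) t-sn dt refl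
     | abs-⊵ a₂ (avoids-· (avoids-·ʳ (avoids-·ˡ av)) (avoids-·ʳ av)) t-sn dt refl
... | d₁ , w₁≡ | d₂ , w₂≡ = simulated (⊵-· d₁ d₂) (by-weight refl (s≤s (≤-reflexive (cong₂ _+_ w₁≡ w₂≡))))
simulate βI (⊵-· (⊵-atom I) du) = simulated du (by-reduction [ βI ]⁺)
simulate βI (⊵-mark I-abs _ _ dt refl) = simulated dt (by-weight (sym ([≔]-var-≡ _ _)) (n<1+n _))
simulate ηKK (⊵-· (⊵-· (⊵-atom S) (⊵-· (⊵-atom K) du)) (⊵-· (⊵-atom K) dv)) =
  simulated (⊵-· (⊵-atom K) (⊵-· du dv)) (by-reduction [ ηKK ]⁺)
simulate ηKI (⊵-· (⊵-· (⊵-atom S) (⊵-· (⊵-atom K) du)) (⊵-atom I)) = simulated du (by-reduction [ ηKI ]⁺)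
simulate (appL r) (⊵-· da db) with simulate r da
... | simulated da₁ ≺da = simulated (⊵-· da₁ db) (≺-·ˡ db ≺da)
simulate (appR r) (⊵-· da db) with simulate r db
... | simulated db₁ ≺db = simulated (⊵-· da db₁) (≺-·ʳ da ≺db)
simulate (appL r) (⊵-mark p av t-sn dt refl) = simulate-mark-head p av t-sn dt r
simulate (appR r) (⊵-mark p av (acc _) dt refl) = simulate-mark-arg p av r dt (simulate r dt)
simulate (ξ A≡ B≡ refl y∈u r) d =
  simulate-ƛ (trans (cong₂ (λ a b → S · a · b) A≡ B≡) (sym (ƛ-app y∈u))) (simulate r) d

mutual
  ⊵-SN-acc : ∀ {zs s s′} (d : zs ⊢ s ⊵ s′) → Acc (TransClosure _⇐_) s′ → ∀ {n} → Acc _<_ n →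
             weight d ≤ n → Acc _◁_ (erased d) → SN s
  ⊵-SN-acc d s′-acc n-acc w≤n erased-acc = acc λ r → ⊵-SN-step d s′-acc n-acc w≤n erased-acc (simulate r d)

  ⊵-SN-step : ∀ {zs s s′ s₁} (d : zs ⊢ s ⊵ s′) → Acc (TransClosure _⇐_) s′ → ∀ {n} → Acc _<_ n →
              weight d ≤ n → Acc _◁_ (erased d) → Simulated d s₁ → SN s₁
  ⊵-SN-step d (acc s′-rec) _ _ _ (simulated d₁ (by-reduction p)) =
    ⊵-SN-acc d₁ (s′-rec p) (<-wellFounded _) ≤-refl (◁-wellFounded _)
  ⊵-SN-step d s′-acc (acc n-rec) w≤n _ (simulated d₁ (by-weight refl lt)) =
    ⊵-SN-acc d₁ s′-acc (n-rec (<-≤-trans lt w≤n)) ≤-refl (◁-wellFounded _)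
  ⊵-SN-step d s′-acc n-acc w≤n (acc erased-rec) (simulated d₁ (by-erased refl w≡ q)) =
    ⊵-SN-acc d₁ s′-acc n-acc (subst (_≤ _) (sym w≡) w≤n) (erased-rec q)

⊵-SN : ∀ {zs s s′} → zs ⊢ s ⊵ s′ → SN s′ → SN s
⊵-SN d s′-sn = ⊵-SN-acc d (Plus.accessible _⇐_ s′-sn) (<-wellFounded _) ≤-refl (◁-wellFounded _)

-- Highly normalizing combinators

I-redex-⊵ : ∀ {t} → SN t → [] ⊢ I · t ⊵ t
I-redex-⊵ {t} t-sn = ⊵-mark {x = 0} I-abs [] t-sn (⊵-refl t) (sym ([≔]-var-≡ 0 t))

K-redex-⊵ : ∀ {t₁ t₂} → SN t₂ → [] ⊢ K · t₁ · t₂ ⊵ t₁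
K-redex-⊵ {t₁} {t₂} t₂-sn = ⊵-mark (K-abs (fresh-∉ t₁)) [] t₂-sn (⊵-refl t₂) (sym ([≔]-∉ t₁ (fresh-∉ t₁)))

S-redex-⊵ : ∀ {x t₁ t₂ t₃} → ¬ x ∈ t₁ → ¬ x ∈ t₂ → SN t₃ → [] ⊢ S · t₁ · t₂ · t₃ ⊵ t₁ · t₃ · (t₂ · t₃)
S-redex-⊵ {t₃ = t₃} x∉t₁ x∉t₂ t₃-sn =
  ⊵-mark (S-abs (η-abs x∉t₁) (η-abs x∉t₂)) [] t₃-sn (⊵-refl t₃) (sym (cong₂ _·_ ([≔]-η x∉t₁) ([≔]-η x∉t₂)))

⊵-·* : ∀ {zs a a′} ts → zs ⊢ a ⊵ a′ → zs ⊢ a ·* ts ⊵ a′ ·* ts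
⊵-·* [] d = d
⊵-·* (t ∷ ts) d = ⊵-·* ts (⊵-· d (⊵-refl t))

sn-·ˡ : ∀ {a b} → SN (a · b) → SN a
sn-·ˡ (acc rs) = acc λ r → sn-·ˡ (rs (appL r))

sn-·ʳ : ∀ {a b} → SN (a · b) → SN b
sn-·ʳ (acc rs) = acc λ r → sn-·ʳ (rs (appR r))

sn-·*-head : ∀ t ts → SN (t ·* ts) → SN t
sn-·*-head t [] t-sn = t-sn
sn-·*-head t (u ∷ us) tus-sn = sn-·ˡ (sn-·*-head (t · u) us tus-sn)

sn-K· : ∀ {t} → SN t → SN (K · t)
sn-K· (acc rs) = acc λ { (appR r) → sn-K· (rs r) }

sn-S· : ∀ {t} → SN t → SN (S · t)
sn-S· (acc rs) = acc λ { (appR r) → sn-S· (rs r) }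

data Neutral : Comb → Set where
  var : ∀ {x} → Neutral (var x)
  app : ∀ {a b} → Neutral a → Neutral (a · b)

neutral-⇒ : ∀ {a a₁} → Neutral a → a ⇒ a₁ → Neutral a₁
neutral-⇒ (app n) (appL r) = app (neutral-⇒ n r)
neutral-⇒ (app n) (appR r) = app n
neutral-⇒ (app (app ())) βK
neutral-⇒ (app (app (app ()))) βS
neutral-⇒ (app ()) βI
neutral-⇒ (app (app ())) ηKK
neutral-⇒ (app (app ())) ηKI
neutral-⇒ (app (app ())) (ξ _ _ _ _ _)

sn-neutral-· : ∀ {a b} → Neutral a → SN a → SN b → SN (a · b)
sn-neutral-· n a-sn@(acc ra) b-sn@(acc rb) = acc (reduct-sn n)
  where
  reduct-sn : ∀ {c} → Neutral _ → _ · _ ⇒ c → SN c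
  reduct-sn n (appL r) = sn-neutral-· (neutral-⇒ n r) (ra r) b-sn
  reduct-sn n (appR r) = sn-neutral-· n a-sn (rb r)
  reduct-sn (app ()) βK
  reduct-sn (app (app ())) βS
  reduct-sn () βI
  reduct-sn (app ()) ηKK
  reduct-sn (app ()) ηKI
  reduct-sn (app ()) (ξ _ _ _ _ _)

sn-neutral-·* : ∀ {a} ts → Neutral a → SN a → All SN ts → SN (a ·* ts)
sn-neutral-·* [] _ a-sn [] = a-sn
sn-neutral-·* (t ∷ ts) n a-sn (t-sn ∷ ts-sn) = sn-neutral-·* ts (app n) (sn-neutral-· n a-sn t-sn) ts-sn

sn-var : ∀ {x} → SN (var x)
sn-var = acc λ ()

mutual
  hn⇒sn : ∀ {t} → HN t → SN t
  hn⇒sn hn-S = acc λ ()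
  hn⇒sn hn-K = acc λ ()
  hn⇒sn hn-I = acc λ ()
  hn⇒sn (hn-var x {ts} hs) = sn-neutral-·* ts var sn-var (all-hn⇒sn hs)
  hn⇒sn (hn-K1 h) = sn-K· (hn⇒sn h)
  hn⇒sn (hn-S1 h) = sn-S· (hn⇒sn h)
  hn⇒sn (hn-S2 x x∉t₁ x∉t₂ h) =
    sn-·ˡ (⊵-SN (S-redex-⊵ (∉-occurs x∉t₁) (∉-occurs x∉t₂) sn-var) (hn⇒sn h))
  hn⇒sn (hn-I* {t₁} {ts} h) =
    ⊵-SN (⊵-·* ts (I-redex-⊵ (sn-·*-head t₁ ts (hn⇒sn h)))) (hn⇒sn h)
  hn⇒sn (hn-K* {ts = ts} h₁ h₂) = ⊵-SN (⊵-·* ts (K-redex-⊵ (hn⇒sn h₂))) (hn⇒sn h₁)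
  hn⇒sn (hn-S* {t₁} {t₂} {t₃} {ts} h) =
    ⊵-SN (⊵-·* ts (S-redex-⊵ (x∉ ∘ left) (x∉ ∘ right) t₃-sn)) (hn⇒sn h)
    where
    x∉ = fresh-∉ (t₁ · t₂)
    t₃-sn = sn-·ʳ (sn-·ʳ (sn-·*-head (t₁ · t₃ · (t₂ · t₃)) ts (hn⇒sn h)))

  all-hn⇒sn : ∀ {ts} → All HN ts → All SN ts
  all-hn⇒sn [] = []
  all-hn⇒sn (h ∷ hs) = hn⇒sn h ∷ all-hn⇒sn hs

sn⇒StronglyNormalizing : ∀ {t} → SN t → StronglyNormalizing t
sn⇒StronglyNormalizing (acc rs) (f , refl , steps) =
  sn⇒StronglyNormalizing (rs (⟶⇒⇒ (steps 0))) (f ∘ suc , refl , steps ∘ suc)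

lemma24 : ∀ t → HN t → StronglyNormalizing t
lemma24 t h = sn⇒StronglyNormalizing (hn⇒sn h)
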